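{- For every $n\in\mathbb{N}$, \[ n! = \left\lfloor 2^{3n^3} \Big/ \left( \left\lfloor \frac{2^{2(2^{3n^2}+2)((2^{3n^2}+1)^2+n+1)}} {2^{2(2^{3n^2}+2)^2} - 2^{2(2^{3n^2}+2)} - 1}\right\rfloor \bmod 2^{2(2^{3n^2}+2)} \right) \right\rfloor . \]
   Context: $0!=1$; $x \bmod y$ denotes the least nonnegative remainder of $x$ upon division by the positive integer $y$; $\lfloor\cdot\rfloor$ is the floor function. -}

module Defs where

open import Data.Nat using (ℕ; suc; _+_; _*_; _∸_; _^_; NonZero)
open import Data.Nat.DivMod using (_/_; _%_)

K : ℕ → ℕ
K n = 2 ^ (3 * (n * n)) + 2

numer : ℕ → ℕ
numer n = 2 ^ (2 * K n * ((2 ^ (3 * (n * n)) + 1) ^ 2 + n + 1))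

-- denominator 2^{2K^2} - 2^{2K} - 1 (positive, so truncated subtraction is exact)
denom : ℕ → ℕ
denom n = 2 ^ (2 * (K n ^ 2)) ∸ 2 ^ (2 * K n) ∸ 1

modulus : ℕ → ℕ
modulus n = 2 ^ (2 * K n)

{-# OPTIONS --safe #-}

-- Put a = 2^(3n²), x = 2^(2K) with K = a + 2, and y = x + 1. The expansion
-- 1 / (x^K − y) = Σ_j y^j / x^(K(j+1)) writes the powers of y in blocks of K base-x
-- digits; the exponent of the numerator is chosen so that the truncated quotient
-- ⌊x^M / (x^K − y)⌋ ends with the digit of y^a at x^(a−n), i.e. C(a, a−n) = C(a, n).
-- Since x > 2^(a+1), the binomial digits of y^a do not carry. Finally
-- a^n / C(a, n) = n! · a^n / (a(a−1)⋯(a−n+1)) lies in [n!, n! + 1) because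
-- a > n! · n² · 2^n.

module Submission where

open import Defs
open import Data.Nat using (ℕ; zero; suc; _+_; _*_; _∸_; _^_; NonZero; _!; _≤_; _<_; z≤n; s≤s; s≤s⁻¹; >-nonZero)
open import Data.Nat.DivMod
open import Data.Nat.Properties
open import Data.Nat.Combinatorics using (_C_; _P_; nCk+nC[k+1]≡[n+1]C[k+1]; nCk≡nC[n∸k]; nCk≡nPk/k!; nPk≡n!/[n∸k]!)
open import Data.Nat.Combinatorics.Base using (_P′_)
open import Data.Nat.Combinatorics.Specification using (nP′k≡n!/[n∸k]!; k!∣nP′k)
open import Data.Nat.Tactic.RingSolver using (solve-∀)
open import Data.Product using (Σ; ∃; ∃₂; _,_; _×_; proj₁; proj₂)
open import Relation.Binary.PropositionalEquality

/-unique : ∀ {m d q} .{{_ : NonZero d}} → q * d ≤ m → m < suc q * d → m / d ≡ q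
/-unique {m} {d} {q} q*d≤m m<[1+q]*d = ≤-antisym
  (s≤s⁻¹ (m<n*o⇒m/o<n m<[1+q]*d))
  (subst (_≤ m / d) (m*n/n≡m q d) (/-monoˡ-≤ d q*d≤m))

[r+q*d]/d≡q : ∀ {r} q d .{{_ : NonZero d}} → r < d → (r + q * d) / d ≡ q
[r+q*d]/d≡q {r} q d r<d = /-unique (m≤n+m (q * d) r) (+-monoˡ-< (q * d) r<d)

[r+q*d]%d≡r : ∀ {r} q d .{{_ : NonZero d}} → r < d → (r + q * d) % d ≡ r
[r+q*d]%d≡r {r} q d r<d = trans ([m+kn]%n≡m%n r q d) (m<n⇒m%n≡m r<d)

r+q*d<e*d : ∀ {r q d e} → r < d → q < e → r + q * d < e * d
r+q*d<e*d {r} {q} {d} {e} r<d q<e = begin-strict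
  r + q * d  <⟨ +-monoˡ-< (q * d) r<d ⟩
  suc q * d  ≤⟨ *-monoˡ-≤ d q<e ⟩
  e * d      ∎
  where open ≤-Reasoning

nP′k≢0 : ∀ {n k} → k ≤ n → NonZero (n P′ k)
nP′k≢0 {n} {zero}  _   = _
nP′k≢0 {n} {suc k} k<n = m*n≢0 (n ∸ k) (n P′ k) {{>-nonZero (m<n⇒0<n∸m k<n)}} {{nP′k≢0 (<⇒≤ k<n)}}

nCk*k!≡nP′k : ∀ {n k} → k ≤ n → (n C k) * k ! ≡ n P′ k
nCk*k!≡nP′k {n} {k} k≤n = begin
  (n C k) * k !           ≡⟨ cong (_* k !) (nCk≡nPk/k! k≤n) ⟩
  (n P k) / k ! * k !     ≡⟨ cong (λ p → p / k ! * k !) nPk≡nP′k ⟩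
  (n P′ k) / k ! * k !    ≡⟨ m/n*n≡m (k!∣nP′k k≤n) ⟩
  n P′ k                  ∎
  where
  open ≡-Reasoning
  instance _ = k !≢0
  nPk≡nP′k : n P k ≡ n P′ k
  nPk≡nP′k = trans (nPk≡n!/[n∸k]! k≤n) (sym (nP′k≡n!/[n∸k]! k≤n))

nCk≢0 : ∀ {n k} → k ≤ n → NonZero (n C k)
nCk≢0 {n} {k} k≤n = m*n≢0⇒m≢0 (n C k) {{subst NonZero (sym (nCk*k!≡nP′k k≤n)) (nP′k≢0 k≤n)}}

nP′k≤n^k : ∀ n k → n P′ k ≤ n ^ k
nP′k≤n^k n zero    = ≤-refl
nP′k≤n^k n (suc k) = *-mono-≤ (m∸n≤m n k) (nP′k≤n^k n k)

n^k≤2^k*nP′k : ∀ n k → 2 * k ≤ n → n ^ k ≤ 2 ^ k * (n P′ k)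
n^k≤2^k*nP′k n zero    _        = ≤-refl
n^k≤2^k*nP′k n (suc k) 2[1+k]≤n = begin
  n * n ^ k                          ≤⟨ *-monoʳ-≤ n (n^k≤2^k*nP′k n k 2k≤n) ⟩
  n * (2 ^ k * (n P′ k))             ≤⟨ *-monoˡ-≤ (2 ^ k * (n P′ k)) n≤2[n∸k] ⟩
  2 * (n ∸ k) * (2 ^ k * (n P′ k))   ≡⟨ regroup (n ∸ k) (2 ^ k) (n P′ k) ⟩
  2 * 2 ^ k * ((n ∸ k) * (n P′ k))   ∎
  where
  open ≤-Reasoning
  regroup : ∀ d t p → 2 * d * (t * p) ≡ 2 * t * (d * p)
  regroup = solve-∀
  2k≤n : 2 * k ≤ n
  2k≤n = ≤-trans (*-monoʳ-≤ 2 (n≤1+n k)) 2[1+k]≤n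
  k≤n∸k : k ≤ n ∸ k
  k≤n∸k = m+n≤o⇒m≤o∸n k (subst (_≤ n) (cong (k +_) (+-identityʳ k)) 2k≤n)
  n≤2[n∸k] : n ≤ 2 * (n ∸ k)
  n≤2[n∸k] = begin
    n                    ≡⟨ m∸n+n≡m (≤-trans k≤n∸k (m∸n≤m n k)) ⟨
    (n ∸ k) + k          ≤⟨ +-monoʳ-≤ (n ∸ k) k≤n∸k ⟩
    (n ∸ k) + (n ∸ k)    ≡⟨ cong ((n ∸ k) +_) (+-identityʳ (n ∸ k)) ⟨
    2 * (n ∸ k)          ∎

n*n^k≤n*nP′k+k*k*n^k : ∀ {n k} → k ≤ n → n * n ^ k ≤ n * (n P′ k) + k * k * n ^ k
n*n^k≤n*nP′k+k*k*n^k {n} {zero}  _   = ≤-reflexive (sym (+-identityʳ (n * 1)))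
n*n^k≤n*nP′k+k*k*n^k {n} {suc k} k<n = begin
  n * (n * A)                                  ≤⟨ *-monoʳ-≤ n (n*n^k≤n*nP′k+k*k*n^k (<⇒≤ k<n)) ⟩
  n * (n * G + k * k * A)                      ≡⟨ cong (λ m → n * (m * G + k * k * A)) (m∸n+n≡m (<⇒≤ k<n)) ⟨
  n * ((d + k) * G + k * k * A)                ≡⟨ split n d k G A ⟩
  n * (d * G) + k * (n * G) + k * k * (n * A)  ≤⟨ +-monoˡ-≤ (k * k * (n * A)) (+-monoʳ-≤ (n * (d * G)) (*-monoʳ-≤ k (*-monoʳ-≤ n (nP′k≤n^k n k)))) ⟩
  n * (d * G) + k * (n * A) + k * k * (n * A)  ≡⟨ merge (n * (d * G)) k (n * A) ⟩
  n * (d * G) + k * suc k * (n * A)            ≤⟨ +-monoʳ-≤ (n * (d * G)) (*-monoˡ-≤ (n * A) (*-monoˡ-≤ (suc k) (n≤1+n k))) ⟩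
  n * (d * G) + suc k * suc k * (n * A)        ∎
  where
  open ≤-Reasoning
  A G d : ℕ
  A = n ^ k
  G = n P′ k
  d = n ∸ k
  split : ∀ n d k G A → n * ((d + k) * G + k * k * A) ≡ n * (d * G) + k * (n * G) + k * k * (n * A)
  split = solve-∀
  merge : ∀ u k v → u + k * v + k * k * v ≡ u + k * suc k * v
  merge = solve-∀

k!*n^k<[1+k!]*nP′k : ∀ n k → 2 * k ≤ n → k ! * (k * k) * 2 ^ k < n →
                     k ! * n ^ k < suc (k !) * (n P′ k)
k!*n^k<[1+k!]*nP′k n k 2k≤n small = *-cancelˡ-< n (f * A) (suc f * F) (begin-strict
  n * (f * A)                            ≡⟨ swap n f A ⟩
  f * (n * A)                            ≤⟨ *-monoʳ-≤ f (n*n^k≤n*nP′k+k*k*n^k k≤n) ⟩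
  f * (n * F + k * k * A)                ≤⟨ *-monoʳ-≤ f (+-monoʳ-≤ (n * F) (*-monoʳ-≤ (k * k) (n^k≤2^k*nP′k n k 2k≤n))) ⟩
  f * (n * F + k * k * (2 ^ k * F))      ≡⟨ expand f n F (k * k) (2 ^ k) ⟩
  f * (n * F) + f * (k * k) * 2 ^ k * F  <⟨ +-monoʳ-< (f * (n * F)) (*-monoˡ-< F small) ⟩
  f * (n * F) + n * F                    ≡⟨ collect f n F ⟩
  n * (suc f * F)                        ∎)
  where
  open ≤-Reasoning
  f A F : ℕ
  f = k !
  A = n ^ k
  F = n P′ k
  k≤n : k ≤ n
  k≤n = ≤-trans (m≤m+n k (k + 0)) 2k≤n
  instance _ = nP′k≢0 k≤n
  swap : ∀ n f A → n * (f * A) ≡ f * (n * A)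
  swap = solve-∀
  expand : ∀ f n F s t → f * (n * F + s * (t * F)) ≡ f * (n * F) + f * s * t * F
  expand = solve-∀
  collect : ∀ f n F → f * (n * F) + n * F ≡ n * (suc f * F)
  collect = solve-∀

n^k/nCk≡k! : ∀ n k → 2 * k ≤ n → k ! * (k * k) * 2 ^ k < n → .{{_ : NonZero (n C k)}} →
             n ^ k / (n C k) ≡ k !
n^k/nCk≡k! n k 2k≤n small = /-unique lower upper
  where
  open ≤-Reasoning
  c : ℕ
  c = n C k
  c*k!≡F : c * k ! ≡ n P′ k
  c*k!≡F = nCk*k!≡nP′k (≤-trans (m≤m+n k (k + 0)) 2k≤n)
  lower : k ! * c ≤ n ^ k
  lower = begin
    k ! * c   ≡⟨ *-comm (k !) c ⟩
    c * k !   ≡⟨ c*k!≡F ⟩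
    n P′ k    ≤⟨ nP′k≤n^k n k ⟩
    n ^ k     ∎
  upper : n ^ k < suc (k !) * c
  upper = *-cancelˡ-< (k !) (n ^ k) (suc (k !) * c) (begin-strict
    k ! * n ^ k              <⟨ k!*n^k<[1+k!]*nP′k n k 2k≤n small ⟩
    suc (k !) * (n P′ k)     ≡⟨ cong (suc (k !) *_) c*k!≡F ⟨
    suc (k !) * (c * k !)    ≡⟨ swap (k !) c ⟩
    k ! * (suc (k !) * c)    ∎)
    where
    swap : ∀ f c → suc f * (c * f) ≡ f * (suc f * c)
    swap = solve-∀

geometricSum : ℕ → ℕ → ℕ → ℕ
geometricSum X y zero    = 0
geometricSum X y (suc J) = X * geometricSum X y J + y ^ J

telescope : ∀ {X y} → y ≤ X → ∀ J → X ^ J ≡ (X ∸ y) * geometricSum X y J + y ^ J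
telescope {X} {y} y≤X zero    = cong (_+ 1) (sym (*-zeroʳ (X ∸ y)))
telescope {X} {y} y≤X (suc J) = begin
  X * X ^ J                              ≡⟨ cong (X *_) (telescope y≤X J) ⟩
  X * (d * S + y ^ J)                    ≡⟨ cong (λ Z → Z * (d * S + y ^ J)) d+y≡X ⟨
  (d + y) * (d * S + y ^ J)              ≡⟨ expand d y S (y ^ J) ⟩
  d * ((d + y) * S + y ^ J) + y * y ^ J  ≡⟨ cong (λ Z → d * (Z * S + y ^ J) + y * y ^ J) d+y≡X ⟩
  d * (X * S + y ^ J) + y * y ^ J        ∎
  where
  open ≡-Reasoning
  d S : ℕ
  d = X ∸ y
  S = geometricSum X y J
  d+y≡X : d + y ≡ X
  d+y≡X = m∸n+n≡m y≤X
  expand : ∀ d y S t → (d + y) * (d * S + t) ≡ d * ((d + y) * S + t) + y * t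
  expand = solve-∀

[x+1]^a≡1+x*h : ∀ x a → ∃ λ h → (x + 1) ^ a ≡ 1 + x * h
[x+1]^a≡1+x*h x zero    = 0 , cong suc (sym (*-zeroʳ x))
[x+1]^a≡1+x*h x (suc a) with [x+1]^a≡1+x*h x a
... | h , eq = 1 + h * (x + 1) , trans (cong ((x + 1) *_) eq) (expand x h)
  where
  expand : ∀ x h → (x + 1) * (1 + x * h) ≡ 1 + x * (1 + h * (x + 1))
  expand = solve-∀

-- l is the part of (x + 1) ^ a below x ^ e; the bound on l is the inductive form
-- of l < x ^ e, which follows as soon as 2 ^ a < x.
binomial-digits : ∀ x .{{_ : NonZero x}} a e → ∃₂ λ l h →
  (x + 1) ^ a ≡ l + x ^ e * (a C e + x * h) × l * x ≤ 2 ^ a * x ^ e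
binomial-digits x zero zero = 0 , 0 , one x , z≤n
  where
  one : ∀ x → 1 ≡ 1 * (1 + x * 0)
  one = solve-∀
binomial-digits x zero (suc e) = 1 , 0 , one (x ^ suc e) x , *-monoʳ-≤ 1 (m≤m*n x (x ^ e) {{m^n≢0 x e}})
  where
  one : ∀ u x → 1 ≡ 1 + u * (x * 0)
  one = solve-∀
binomial-digits x (suc a) zero with [x+1]^a≡1+x*h x (suc a)
... | h , eq = 0 , h , trans eq (sym (*-identityˡ _)) , z≤n
binomial-digits x (suc a) (suc e)
  with binomial-digits x a e | binomial-digits x a (suc e)
... | l₁ , h₁ , eq₁ , l₁x≤ | l₂ , h₂ , eq₂ , l₂x≤ = x * l₁ + l₂ , h₁ + h₂ , expansion , bound
  where
  expansion : (x + 1) * (x + 1) ^ a ≡ (x * l₁ + l₂) + x * x ^ e * (suc a C suc e + x * (h₁ + h₂))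
  expansion = begin
    (x + 1) * (x + 1) ^ a
      ≡⟨ *-distribʳ-+ ((x + 1) ^ a) x 1 ⟩
    x * (x + 1) ^ a + 1 * (x + 1) ^ a
      ≡⟨ cong₂ (λ u v → x * u + 1 * v) eq₁ eq₂ ⟩
    x * (l₁ + x ^ e * (a C e + x * h₁)) + 1 * (l₂ + x * x ^ e * (a C suc e + x * h₂))
      ≡⟨ regroup x l₁ l₂ h₁ h₂ (x ^ e) (a C e) (a C suc e) ⟩
    (x * l₁ + l₂) + x * x ^ e * ((a C e + a C suc e) + x * (h₁ + h₂))
      ≡⟨ cong (λ c → (x * l₁ + l₂) + x * x ^ e * (c + x * (h₁ + h₂))) (nCk+nC[k+1]≡[n+1]C[k+1] a e) ⟩
    (x * l₁ + l₂) + x * x ^ e * (suc a C suc e + x * (h₁ + h₂)) ∎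
    where
    open ≡-Reasoning
    regroup : ∀ x l₁ l₂ h₁ h₂ u c₁ c₂ →
      x * (l₁ + u * (c₁ + x * h₁)) + 1 * (l₂ + x * u * (c₂ + x * h₂))
      ≡ (x * l₁ + l₂) + x * u * ((c₁ + c₂) + x * (h₁ + h₂))
    regroup = solve-∀
  bound : (x * l₁ + l₂) * x ≤ 2 * 2 ^ a * (x * x ^ e)
  bound = begin
    (x * l₁ + l₂) * x                          ≡⟨ *-distribʳ-+ x (x * l₁) l₂ ⟩
    x * l₁ * x + l₂ * x                        ≡⟨ cong (_+ l₂ * x) (*-assoc x l₁ x) ⟩
    x * (l₁ * x) + l₂ * x                      ≤⟨ +-mono-≤ (*-monoʳ-≤ x l₁x≤) l₂x≤ ⟩
    x * (2 ^ a * x ^ e) + 2 ^ a * (x * x ^ e)  ≡⟨ regroup x (2 ^ a) (x ^ e) ⟩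
    2 * 2 ^ a * (x * x ^ e)                    ∎
    where
    open ≤-Reasoning
    regroup : ∀ x t u → x * (t * u) + t * (x * u) ≡ 2 * t * (x * u)
    regroup = solve-∀

nCk≤2^n : ∀ n k → n C k ≤ 2 ^ n
nCk≤2^n n       zero    = m^n>0 2 n
nCk≤2^n zero    (suc k) = z≤n
nCk≤2^n (suc n) (suc k) = begin
  suc n C suc k        ≡⟨ nCk+nC[k+1]≡[n+1]C[k+1] n k ⟨
  n C k + n C suc k    ≤⟨ +-mono-≤ (nCk≤2^n n k) (nCk≤2^n n (suc k)) ⟩
  2 ^ n + 2 ^ n        ≡⟨ cong (2 ^ n +_) (+-identityʳ (2 ^ n)) ⟨
  2 ^ suc n            ∎
  where open ≤-Reasoning

[x+1]^j≤2^j*x^j : ∀ {x} → 1 ≤ x → ∀ j → (x + 1) ^ j ≤ 2 ^ j * x ^ j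
[x+1]^j≤2^j*x^j         1≤x zero    = ≤-refl
[x+1]^j≤2^j*x^j {x} 1≤x (suc j) = begin
  (x + 1) * (x + 1) ^ j        ≤⟨ *-mono-≤ x+1≤2x ([x+1]^j≤2^j*x^j 1≤x j) ⟩
  (2 * x) * (2 ^ j * x ^ j)    ≡⟨ regroup x (2 ^ j) (x ^ j) ⟩
  2 * 2 ^ j * (x * x ^ j)      ∎
  where
  open ≤-Reasoning
  x+1≤2x : x + 1 ≤ 2 * x
  x+1≤2x = subst (x + 1 ≤_) (cong (x +_) (sym (+-identityʳ x))) (+-monoʳ-≤ x 1≤x)
  regroup : ∀ x t u → (2 * x) * (t * u) ≡ 2 * t * (x * u)
  regroup = solve-∀

[x+1]^[1+a]+[x+1]<x^[a+2] : ∀ x a → 2 ^ suc a + 3 ≤ x → (x + 1) ^ suc a + (x + 1) < x ^ (a + 2)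
[x+1]^[1+a]+[x+1]<x^[a+2] x a x-large = begin-strict
  (x + 1) ^ suc a + (x + 1)  ≤⟨ +-mono-≤ ([x+1]^j≤2^j*x^j 1≤x (suc a)) (+-mono-≤ x≤Y 1≤Y) ⟩
  B * Y + (Y + Y)            <⟨ +-monoʳ-< (B * Y) (m<m+n (Y + Y) 1≤Y) ⟩
  B * Y + (Y + Y + Y)        ≡⟨ regroup B Y ⟩
  (B + 3) * Y                ≤⟨ *-monoˡ-≤ Y x-large ⟩
  x * Y                      ≡⟨ cong (x ^_) (+-comm 2 a) ⟩
  x ^ (a + 2)                ∎
  where
  open ≤-Reasoning
  B Y : ℕ
  B = 2 ^ suc a
  Y = x ^ suc a
  1≤x : 1 ≤ x
  1≤x = ≤-trans (s≤s z≤n) (≤-trans (m≤n+m 3 B) x-large)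
  instance
    x≢0 : NonZero x
    x≢0 = >-nonZero 1≤x
  1≤Y : 1 ≤ Y
  1≤Y = m^n>0 x (suc a)
  x≤Y : x ≤ Y
  x≤Y = m≤m*n x (x ^ a) {{m^n≢0 x a}}
  regroup : ∀ B Y → B * Y + (Y + Y + Y) ≡ (B + 3) * Y
  regroup = solve-∀

[x+1]^[1+a]<x^[a+2]∸[x+1] : ∀ x a → 2 ^ suc a + 3 ≤ x → (x + 1) ^ suc a < x ^ (a + 2) ∸ (x + 1)
[x+1]^[1+a]<x^[a+2]∸[x+1] x a x-large = m+n≤o⇒m≤o∸n (suc ((x + 1) ^ suc a)) ([x+1]^[1+a]+[x+1]<x^[a+2] x a x-large)

x^[a+2]∸[x+1]≢0 : ∀ x a → 2 ^ suc a + 3 ≤ x → NonZero (x ^ (a + 2) ∸ (x + 1))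
x^[a+2]∸[x+1]≢0 x a x-large = >-nonZero (m<n⇒0<n ([x+1]^[1+a]<x^[a+2]∸[x+1] x a x-large))

module _ (x a n : ℕ) .{{_ : NonZero x}} (n≤a : n ≤ a) (x-large : 2 ^ suc a + 3 ≤ x) where
  private
    y X D T M e : ℕ
    y = x + 1
    X = x ^ (a + 2)
    D = X ∸ y
    T = y ^ suc a
    M = (a + 1) ^ 2 + n + 1
    e = a ∸ n

    e+n≡a : e + n ≡ a
    e+n≡a = m∸n+n≡m n≤a

    y≤X : y ≤ X
    y≤X = ≤-trans (m≤n+m y T) (<⇒≤ ([x+1]^[1+a]+[x+1]<x^[a+2] x a x-large))

    T<D : T < D
    T<D = [x+1]^[1+a]<x^[a+2]∸[x+1] x a x-large

    2^a<x : 2 ^ a < x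
    2^a<x = <-≤-trans (^-monoʳ-< 2 (s≤s (s≤s z≤n)) (n<1+n a)) (≤-trans (m≤m+n _ 3) x-large)

    instance
      xᵉ≢0 : NonZero (x ^ e)
      xᵉ≢0 = m^n≢0 x e

    digits : ∃₂ λ l h → y ^ a ≡ l + x ^ e * (a C e + x * h) × l * x ≤ 2 ^ a * x ^ e
    digits = binomial-digits x a e

    l h c S H Q : ℕ
    l = proj₁ digits
    h = proj₁ (proj₂ digits)
    c = a C e
    S = geometricSum X y a
    H = h + x ^ suc n * S
    Q = c + H * x

    yᵃ≡l+xᵉ*[c+x*h] : y ^ a ≡ l + x ^ e * (c + x * h)
    yᵃ≡l+xᵉ*[c+x*h] = proj₁ (proj₂ (proj₂ digits))

    l*x≤2ᵃ*xᵉ : l * x ≤ 2 ^ a * x ^ e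
    l*x≤2ᵃ*xᵉ = proj₂ (proj₂ (proj₂ digits))

    l<xᵉ : l < x ^ e
    l<xᵉ = *-cancelʳ-< x l (x ^ e) (≤-<-trans l*x≤2ᵃ*xᵉ
      (subst (2 ^ a * x ^ e <_) (*-comm x (x ^ e)) (*-monoˡ-< (x ^ e) 2^a<x)))

    c<x : c < x
    c<x = ≤-<-trans (nCk≤2^n a e) 2^a<x

    e+M≡[a+2]*[a+1] : e + M ≡ (a + 2) * suc a
    e+M≡[a+2]*[a+1] = subst (λ a → e + ((a + 1) ^ 2 + n + 1) ≡ (a + 2) * suc a) e+n≡a (ring e n)
      where
      ring : ∀ e n → e + ((e + n + 1) * ((e + n + 1) * 1) + n + 1) ≡ (e + n + 2) * suc (e + n)
      ring = solve-∀

    X≡xᵉ*x^[n+2] : X ≡ x ^ e * (x * x ^ suc n)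
    X≡xᵉ*x^[n+2] = trans (cong (x ^_) (subst (λ a → a + 2 ≡ e + suc (suc n)) e+n≡a (ring e n)))
                         (^-distribˡ-+-* x e (suc (suc n)))
      where
      ring : ∀ e n → e + n + 2 ≡ e + suc (suc n)
      ring = solve-∀

    -- The last term y ^ a of the geometric sum carries the binomial digit c at
    -- position e; every other term is a multiple of x ^ (e + n + 2).
    xᵉ*xᴹ≡[T+l*D]+Q*[xᵉ*D] : x ^ e * x ^ M ≡ (T + l * D) + Q * (x ^ e * D)
    xᵉ*xᴹ≡[T+l*D]+Q*[xᵉ*D] = begin
      x ^ e * x ^ M            ≡⟨ ^-distribˡ-+-* x e M ⟨
      x ^ (e + M)              ≡⟨ cong (x ^_) e+M≡[a+2]*[a+1] ⟩
      x ^ ((a + 2) * suc a)    ≡⟨ ^-*-assoc x (a + 2) (suc a) ⟨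
      X ^ suc a                ≡⟨ telescope y≤X (suc a) ⟩
      D * (X * S + y ^ a) + T  ≡⟨ cong₂ (λ u v → D * (u * S + v) + T) X≡xᵉ*x^[n+2] yᵃ≡l+xᵉ*[c+x*h] ⟩
      D * (x ^ e * (x * x ^ suc n) * S + (l + x ^ e * (c + x * h))) + T
                               ≡⟨ regroup D (x ^ e) x (x ^ suc n) S l c h T ⟩
      (T + l * D) + Q * (x ^ e * D) ∎
      where
      open ≡-Reasoning
      regroup : ∀ D E x P S l c h T →
        D * (E * (x * P) * S + (l + E * (c + x * h))) + T ≡ (T + l * D) + (c + (h + P * S) * x) * (E * D)
      regroup = solve-∀

    xᴹ/D≡Q : .{{_ : NonZero D}} → x ^ M / D ≡ Q
    xᴹ/D≡Q = begin
      x ^ M / D                                     ≡⟨ m*n/m*o≡n/o (x ^ e) (x ^ M) D ⟨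
      (x ^ e * x ^ M) / (x ^ e * D)                 ≡⟨ /-congˡ {o = x ^ e * D} xᵉ*xᴹ≡[T+l*D]+Q*[xᵉ*D] ⟩
      ((T + l * D) + Q * (x ^ e * D)) / (x ^ e * D) ≡⟨ [r+q*d]/d≡q Q (x ^ e * D) (r+q*d<e*d T<D l<xᵉ) ⟩
      Q                                             ∎
      where
      open ≡-Reasoning
      instance _ = m*n≢0 (x ^ e) D

  digit-of-quotient≡C : .{{_ : NonZero D}} → (x ^ M / D) % x ≡ a C n
  digit-of-quotient≡C = begin
    (x ^ M / D) % x   ≡⟨ %-congˡ xᴹ/D≡Q ⟩
    (c + H * x) % x   ≡⟨ [r+q*d]%d≡r H x c<x ⟩
    a C e             ≡⟨ nCk≡nC[n∸k] n≤a ⟨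
    a C n             ∎
    where open ≡-Reasoning

n<2^n : ∀ n → n < 2 ^ n
n<2^n zero    = s≤s z≤n
n<2^n (suc n) = begin
  1 + suc n      ≤⟨ +-mono-≤ (m^n>0 2 n) (n<2^n n) ⟩
  2 ^ n + 2 ^ n  ≡⟨ cong (2 ^ n +_) (+-identityʳ (2 ^ n)) ⟨
  2 ^ suc n      ∎
  where open ≤-Reasoning

n≤n*n : ∀ n → n ≤ n * n
n≤n*n zero    = z≤n
n≤n*n (suc n) = m≤m*n (suc n) (suc n)

k!≤2^[k*k] : ∀ k → k ! ≤ 2 ^ (k * k)
k!≤2^[k*k] zero    = ≤-refl
k!≤2^[k*k] (suc k) = begin
  suc k * k !                        ≤⟨ *-mono-≤ 1+k≤2^[1+2k] (k!≤2^[k*k] k) ⟩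
  2 ^ suc (k + k) * 2 ^ (k * k)      ≡⟨ ^-distribˡ-+-* 2 (suc (k + k)) (k * k) ⟨
  2 ^ (suc (k + k) + k * k)          ≡⟨ cong (2 ^_) (square k) ⟩
  2 ^ (suc k * suc k)                ∎
  where
  open ≤-Reasoning
  1+k≤2^[1+2k] : suc k ≤ 2 ^ suc (k + k)
  1+k≤2^[1+2k] = ≤-trans (n<2^n k) (^-monoʳ-≤ 2 (≤-trans (m≤m+n k k) (n≤1+n (k + k))))
  square : ∀ k → suc (k + k) + k * k ≡ suc k * suc k
  square = solve-∀

n!*n²*2ⁿ<2^[3n²] : ∀ n → n ! * (n * n) * 2 ^ n < 2 ^ (3 * (n * n))
n!*n²*2ⁿ<2^[3n²] n = begin-strict
  n ! * (n * n) * 2 ^ n  ≤⟨ *-monoʳ-≤ (n ! * (n * n)) (^-monoʳ-≤ 2 (n≤n*n n)) ⟩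
  n ! * (n * n) * u      ≤⟨ *-monoˡ-≤ u (*-monoˡ-≤ (n * n) (k!≤2^[k*k] n)) ⟩
  u * (n * n) * u        <⟨ *-monoˡ-< u (*-monoʳ-< u (n<2^n (n * n))) ⟩
  u * u * u              ≡⟨ cube u ⟩
  u ^ 3                  ≡⟨ ^-*-assoc 2 (n * n) 3 ⟩
  2 ^ (n * n * 3)        ≡⟨ cong (2 ^_) (*-comm (n * n) 3) ⟩
  2 ^ (3 * (n * n))      ∎
  where
  open ≤-Reasoning
  u : ℕ
  u = 2 ^ (n * n)
  instance _ = m^n≢0 2 (n * n)
  cube : ∀ u → u * u * u ≡ u * (u * (u * 1))
  cube = solve-∀

2n≤2^[3n²] : ∀ n → 2 * n ≤ 2 ^ (3 * (n * n))
2n≤2^[3n²] n = <⇒≤ (<-≤-trans (n<2^n (2 * n)) (^-monoʳ-≤ 2 (*-mono-≤ {2} {3} (s≤s (s≤s z≤n)) (n≤n*n n))))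

2^[1+a]+3≤2^[2[a+2]] : ∀ a → 2 ^ suc a + 3 ≤ 2 ^ (2 * (a + 2))
2^[1+a]+3≤2^[2[a+2]] a = begin
  2 ^ suc a + 3              ≤⟨ +-monoʳ-≤ (2 ^ suc a) (m≤m*n 3 (2 ^ suc a) {{m^n≢0 2 (suc a)}}) ⟩
  2 ^ suc a + 3 * 2 ^ suc a  ≡⟨ quadruple (2 ^ a) ⟩
  2 ^ (3 + a)                ≤⟨ ^-monoʳ-≤ 2 (subst (3 + a ≤_) (exponent a) (m≤m+n (3 + a) (suc a))) ⟩
  2 ^ (2 * (a + 2))          ∎
  where
  open ≤-Reasoning
  quadruple : ∀ t → 2 * t + 3 * (2 * t) ≡ 2 * (2 * (2 * t))
  quadruple = solve-∀
  exponent : ∀ a → 3 + a + suc a ≡ 2 * (a + 2)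
  exponent = solve-∀

2^[3n³]≡[2^[3n²]]ⁿ : ∀ n → 2 ^ (3 * (n ^ 3)) ≡ (2 ^ (3 * (n * n))) ^ n
2^[3n³]≡[2^[3n²]]ⁿ n = trans (cong (2 ^_) (regroup n)) (sym (^-*-assoc 2 (3 * (n * n)) n))
  where
  regroup : ∀ n → 3 * (n * (n * (n * 1))) ≡ 3 * (n * n) * n
  regroup = solve-∀

numer-as-modulus-power : ∀ n → numer n ≡ modulus n ^ ((2 ^ (3 * (n * n)) + 1) ^ 2 + n + 1)
numer-as-modulus-power n = sym (^-*-assoc 2 (2 * K n) ((2 ^ (3 * (n * n)) + 1) ^ 2 + n + 1))

denom-as-modulus-power : ∀ n → denom n ≡ modulus n ^ K n ∸ (modulus n + 1)
denom-as-modulus-power n = begin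
  2 ^ (2 * (K n ^ 2)) ∸ x ∸ 1   ≡⟨ cong (λ m → 2 ^ m ∸ x ∸ 1) (regroup (K n)) ⟩
  2 ^ (2 * K n * K n) ∸ x ∸ 1   ≡⟨ cong (λ m → m ∸ x ∸ 1) (^-*-assoc 2 (2 * K n) (K n)) ⟨
  x ^ K n ∸ x ∸ 1               ≡⟨ ∸-+-assoc (x ^ K n) x 1 ⟩
  x ^ K n ∸ (x + 1)             ∎
  where
  open ≡-Reasoning
  x : ℕ
  x = modulus n
  regroup : ∀ k → 2 * (k * (k * 1)) ≡ 2 * k * k
  regroup = solve-∀

n≤2^[3n²] : ∀ n → n ≤ 2 ^ (3 * (n * n))
n≤2^[3n²] n = ≤-trans (m≤m+n n (n + 0)) (2n≤2^[3n²] n)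

denom≢0 : ∀ n → NonZero (denom n)
denom≢0 n = subst NonZero (sym (denom-as-modulus-power n)) (x^[a+2]∸[x+1]≢0 (modulus n) a (2^[1+a]+3≤2^[2[a+2]] a))
  where
  a : ℕ
  a = 2 ^ (3 * (n * n))

digit≡C : ∀ n .{{_ : NonZero (denom n)}} .{{_ : NonZero (modulus n)}} →
          (numer n / denom n) % modulus n ≡ 2 ^ (3 * (n * n)) C n
digit≡C n = trans (%-congˡ (trans (/-congˡ (numer-as-modulus-power n)) (/-congʳ (denom-as-modulus-power n))))
                  (digit-of-quotient≡C (modulus n) a n (n≤2^[3n²] n) (2^[1+a]+3≤2^[2[a+2]] a))
  where
  a : ℕ
  a = 2 ^ (3 * (n * n))
  instance _ = x^[a+2]∸[x+1]≢0 (modulus n) a (2^[1+a]+3≤2^[2[a+2]] a)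

mainTheorem8 : (n : ℕ) →
    Σ (NonZero (denom n)) λ dnz →
    Σ (NonZero (modulus n)) λ mnz →
    Σ (NonZero (((numer n / denom n) {{dnz}} % modulus n) {{mnz}})) λ nz →
      n ! ≡ (2 ^ (3 * (n ^ 3)) / (((numer n / denom n) {{dnz}} % modulus n) {{mnz}})) {{nz}}
mainTheorem8 n = denom≢0 n , modulus≢0 , digit≢0 , sym (begin
  2 ^ (3 * (n ^ 3)) / digit  ≡⟨ /-congˡ {o = digit} (2^[3n³]≡[2^[3n²]]ⁿ n) ⟩
  a ^ n / digit              ≡⟨ /-congʳ (digit≡C n) ⟩
  a ^ n / (a C n)            ≡⟨ n^k/nCk≡k! a n (2n≤2^[3n²] n) (n!*n²*2ⁿ<2^[3n²] n) ⟩
  n !                        ∎)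
  where
  open ≡-Reasoning
  a digit : ℕ
  a = 2 ^ (3 * (n * n))
  instance
    _ = denom≢0 n
    modulus≢0 : NonZero (modulus n)
    modulus≢0 = m^n≢0 2 (2 * K n)
    aCn≢0 : NonZero (a C n)
    aCn≢0 = nCk≢0 (n≤2^[3n²] n)
  digit = (numer n / denom n) % modulus n
  instance
    digit≢0 : NonZero digit
    digit≢0 = subst NonZero (sym (digit≡C n)) aCn≢0
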